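{- For $n\ge1$ let $\mathbf{a}^{(n)}=(a_{n,1},\dots,a_{n,n})$ with $a_{n,k}=\frac{1}{n!}\binom{n}{k}(H_n-H_{n-k})$, $H_m=\sum_{i=1}^m 1/i$, be the coefficient sequence of $A_n(x)=\sum_{k=1}^n a_{n,k}x^{k-1}$. Then for every $1\le n\le 300$, the sequence $\mathbf{a}^{(n)}$ is infinite logconcave.
   Context: For a finite sequence $\mathbf{a}=(a_j)$ indexed by $j$ in a finite interval of integers, define $\mathfrak{L}(\mathbf{a})$ as the sequence on the same index set with entries $a_j^2-a_{j-1}a_{j+1}$, where $a_j=0$ for indices outside the index set. A sequence is $r$-logconcave if $\mathfrak{L}^{(s)}(\mathbf{a})$ has all entries positive for $0\le s\le r$, and infinite logconcave if it is $r$-logconcave for every $r\in\mathbb{N}$. -}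

module Defs where

open import Data.Nat as ℕ using (ℕ; zero; suc; _∸_; _≤_)
open import Data.Nat.Combinatorics using (_C_)
open import Data.Nat.Properties using (_!≢0)
open import Data.Nat.Base using (_!)
open import Data.Integer using (+_)
open import Data.Rational using (ℚ; 0ℚ; _+_; _*_; _-_; _<_; _/_)
open import Data.List using (List; []; _∷_; map; upTo)
open import Data.List.Relation.Unary.All using (All)

H : ℕ → ℚ
H zero    = 0ℚ
H (suc m) = H m + (+ 1 / suc m)

a : ℕ → ℕ → ℚ
a n k = ((+ 1) / (n !)) * ((+ (n C k) / 1) * (H n - H (n ∸ k)))
  where instance _ = n !≢0

seqA : ℕ → List ℚ
seqA n = map (λ k → a n (suc k)) (upTo n)

-- 𝔏 with zero padding outside the index set; the argument is the
-- entry preceding the current one (0 at the left boundary)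
𝔏-go : ℚ → List ℚ → List ℚ
𝔏-go prev []            = []
𝔏-go prev (x ∷ [])      = (x * x - prev * 0ℚ) ∷ []
𝔏-go prev (x ∷ y ∷ xs)  = (x * x - prev * y) ∷ 𝔏-go x (y ∷ xs)

𝔏 : List ℚ → List ℚ
𝔏 = 𝔏-go 0ℚ

𝔏^ : ℕ → List ℚ → List ℚ
𝔏^ zero    xs = xs
𝔏^ (suc s) xs = 𝔏 (𝔏^ s xs)

LogConcave : ℕ → List ℚ → Set
LogConcave r xs = ∀ s → s ≤ r → All (λ x → 0ℚ < x) (𝔏^ s xs)

InfLogConcave : List ℚ → Set
InfLogConcave xs = ∀ r → LogConcave r xs

-- Clearing denominators, (n !)² a_{n,k} is an integer b_{n,k}, and 𝔏 turns c·x into c²·𝔏(x).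
-- So 𝔏^(s)(a^(n)) is a positive multiple of 𝔏^(s)(b_n), and it suffices that every iterate of
-- 𝔏 on the integer sequence b_n is positive. A positive sequence with x_k² ≥ 3 x_{k-1} x_{k+1}
-- keeps this property under 𝔏 (any factor ≥ (3+√5)/2 would do): for y = 𝔏(x) and
-- u = x_{k-1} x_{k+1} one has y_k ≥ 2u, hence 3 y_{k-1} y_{k+1} ≤ 3 u² ≤ (2u)² ≤ y_k².
-- For each n ≤ 300, evaluation checks that a few iterates of 𝔏 on b_n are positive and that
-- the last of them satisfies this criterion.
module Submission where

open import Defs

open import Data.Bool using (Bool; false; T; _∧_; _∨_)
open import Data.Bool.Properties using (T?; T-∧)
open import Data.Integer using (ℤ; +_; -[1+_]; 0ℤ; +≤+; nonNegative; positive; ∣_∣; +<+)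
import Data.Integer.Properties as ℤP
open import Data.List using (List; []; _∷_; map; upTo)
import Data.List.Properties as LP
open import Data.List.Relation.Unary.All as All using (All; all?)
import Data.List.Relation.Unary.All.Properties as All
open import Data.Nat as ℕ using (ℕ; zero; suc; _∸_; _!; z≤n; s≤s)
open import Data.Fin using (Fin; toℕ; fromℕ<)
import Data.Fin.Properties as FinP
open import Data.Nat.GeneralisedArithmetic using (iterate; iterate-is-fold)
import Data.Nat.Properties as ℕP
open import Data.Nat.Combinatorics using (_C_; _P_; nPk≡n!/[n∸k]!)
open import Data.Nat.DivMod using (m/n*n≡m)
open import Data.Nat.Divisibility using (m≤n⇒m!∣n!)
open import Data.Product using (_×_; _,_; proj₁; proj₂; ∃-syntax)
open import Data.Unit using (⊤; tt)
open import Function using (Equivalence; _∘_)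
open import Relation.Binary.PropositionalEquality using (_≡_; refl; sym; trans; cong; cong₂; subst; module ≡-Reasoning)
open import Relation.Nullary using (Dec; yes; no; _×-dec_)
open import Relation.Nullary.Decidable using (isYes; toWitness; from-yes)

module _ where
  open import Data.Integer using (_+_; _-_; _*_; _≤_; _<_)
  open import Data.Integer.Tactic.RingSolver using (solve)
  open ℤP.≤-Reasoning

  head₀ : List ℤ → ℤ
  head₀ []      = 0ℤ
  head₀ (x ∷ _) = x

  𝔏ℤ-go : ℤ → List ℤ → List ℤ
  𝔏ℤ-go p []       = []
  𝔏ℤ-go p (x ∷ xs) = x * x - p * head₀ xs ∷ 𝔏ℤ-go x xs

  𝔏ℤ : List ℤ → List ℤ
  𝔏ℤ = 𝔏ℤ-go 0ℤ

  ThreeFactorLC : ℤ → List ℤ → Set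
  ThreeFactorLC q []       = ⊤
  ThreeFactorLC q (x ∷ xs) = 0ℤ < x × + 3 * (q * head₀ xs) ≤ x * x × ThreeFactorLC x xs

  *-mono-≤-nonNeg : ∀ {a b c d} → 0ℤ ≤ a → a ≤ b → 0ℤ ≤ c → c ≤ d → a * c ≤ b * d
  *-mono-≤-nonNeg {b = b} {c} 0≤a a≤b 0≤c c≤d = ℤP.≤-trans
    (ℤP.*-monoʳ-≤-nonNeg c {{nonNegative 0≤c}} a≤b)
    (ℤP.*-monoˡ-≤-nonNeg b {{nonNegative (ℤP.≤-trans 0≤a a≤b)}} c≤d)

  *-nonNeg : ∀ {a b} → 0ℤ ≤ a → 0ℤ ≤ b → 0ℤ ≤ a * b
  *-nonNeg 0≤a 0≤b = *-mono-≤-nonNeg ℤP.≤-refl 0≤a ℤP.≤-refl 0≤b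

  3*u≤x⇒u≤x : ∀ {u x} → 0ℤ ≤ u → + 3 * u ≤ x → u ≤ x
  3*u≤x⇒u≤x {u} {x} 0≤u 3u≤x = begin
    u             ≤⟨ ℤP.i≤i+j u (+ 2 * u) {{nonNegative (*-nonNeg {+ 2} (+≤+ z≤n) 0≤u)}} ⟩
    u + + 2 * u   ≡⟨ solve (u ∷ []) ⟩
    + 3 * u       ≤⟨ 3u≤x ⟩
    x             ∎

  3*u≤x⇒2*u≤x-u : ∀ {u x} → + 3 * u ≤ x → + 2 * u ≤ x - u
  3*u≤x⇒2*u≤x-u {u} {x} 3u≤x = begin
    + 2 * u                   ≤⟨ ℤP.i≤i+j (+ 2 * u) (x - + 3 * u) {{nonNegative (ℤP.i≤j⇒0≤j-i 3u≤x)}} ⟩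
    + 2 * u + (x - + 3 * u)   ≡⟨ solve (u ∷ x ∷ []) ⟩
    x - u                     ∎

  3*u≤x⇒0<x-u : ∀ {u x} → 0ℤ < x → + 3 * u ≤ x → 0ℤ < x - u
  3*u≤x⇒0<x-u {u} {x} 0<x 3u≤x = ℤP.*-cancelˡ-<-nonNeg {0ℤ} {x - u} (+ 3) (begin-strict
    0ℤ                      <⟨ ℤP.+-mono-<-≤ 0<x (ℤP.+-mono-≤ (ℤP.<⇒≤ 0<x) (ℤP.i≤j⇒0≤j-i 3u≤x)) ⟩
    x + (x + (x - + 3 * u)) ≡⟨ solve (u ∷ x ∷ []) ⟩
    + 3 * (x - u)           ∎)

  0<x⇒0<x*x : ∀ {x} → 0ℤ < x → 0ℤ < x * x
  0<x⇒0<x*x {x} 0<x = ℤP.*-monoʳ-<-pos x {{positive 0<x}} 0<x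

  3*[u*u]≤[2*u]*[2*u] : ∀ {u} → 0ℤ ≤ u → + 3 * (u * u) ≤ (+ 2 * u) * (+ 2 * u)
  3*[u*u]≤[2*u]*[2*u] {u} 0≤u = begin
    + 3 * (u * u)           ≤⟨ ℤP.i≤i+j (+ 3 * (u * u)) (u * u) {{nonNegative (*-nonNeg 0≤u 0≤u)}} ⟩
    + 3 * (u * u) + u * u   ≡⟨ solve (u ∷ []) ⟩
    (+ 2 * u) * (+ 2 * u)   ∎

  𝔏-entry-ratio : ∀ {p y q w X} → 0ℤ ≤ p → 0ℤ ≤ y → + 3 * (p * y) ≤ X →
                  0ℤ ≤ q → q ≤ p * p → 0ℤ ≤ w → w ≤ y * y →
                  + 3 * (q * w) ≤ (X - p * y) * (X - p * y)
  𝔏-entry-ratio {p} {y} {q} {w} {X} 0≤p 0≤y 3u≤X 0≤q q≤p² 0≤w w≤y² = begin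
    + 3 * (q * w)                 ≤⟨ ℤP.*-monoˡ-≤-nonNeg (+ 3) (*-mono-≤-nonNeg 0≤q q≤p² 0≤w w≤y²) ⟩
    + 3 * (p * p * (y * y))       ≡⟨ solve (p ∷ y ∷ []) ⟩
    + 3 * (p * y * (p * y))       ≤⟨ 3*[u*u]≤[2*u]*[2*u] 0≤u ⟩
    + 2 * (p * y) * (+ 2 * (p * y)) ≤⟨ *-mono-≤-nonNeg 0≤2u 2u≤v 0≤2u 2u≤v ⟩
    (X - p * y) * (X - p * y)     ∎
    where
    0≤u = *-nonNeg 0≤p 0≤y
    0≤2u = *-nonNeg {+ 2} (+≤+ z≤n) 0≤u
    2u≤v = 3*u≤x⇒2*u≤x-u 3u≤X

  ThreeFactorLC⇒head₀-nonNeg : ∀ {q} xs → ThreeFactorLC q xs → 0ℤ ≤ head₀ xs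
  ThreeFactorLC⇒head₀-nonNeg []      _             = ℤP.≤-refl
  ThreeFactorLC⇒head₀-nonNeg (_ ∷ _) (0<x , _ , _) = ℤP.<⇒≤ 0<x

  head₀-𝔏ℤ-go-bounds : ∀ {p} xs → 0ℤ ≤ p → ThreeFactorLC p xs →
                       0ℤ ≤ head₀ (𝔏ℤ-go p xs) × head₀ (𝔏ℤ-go p xs) ≤ head₀ xs * head₀ xs
  head₀-𝔏ℤ-go-bounds []           _   _                = ℤP.≤-refl , ℤP.≤-refl
  head₀-𝔏ℤ-go-bounds {p} (x ∷ xs) 0≤p (_ , 3pz≤x² , lc) =
    ℤP.i≤j⇒0≤j-i (3*u≤x⇒u≤x 0≤pz 3pz≤x²) , ℤP.i-j≤i (x * x) (p * head₀ xs) {{nonNegative 0≤pz}}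
    where 0≤pz = *-nonNeg 0≤p (ThreeFactorLC⇒head₀-nonNeg xs lc)

  𝔏ℤ-go-preserves-ThreeFactorLC : ∀ {p q} xs → 0ℤ ≤ p → 0ℤ ≤ q → q ≤ p * p →
                            ThreeFactorLC p xs → ThreeFactorLC q (𝔏ℤ-go p xs)
  𝔏ℤ-go-preserves-ThreeFactorLC []       _   _   _    _ = tt
  𝔏ℤ-go-preserves-ThreeFactorLC (x ∷ xs) 0≤p 0≤q q≤p² lc@(0<x , 3pz≤x² , lc′) =
      3*u≤x⇒0<x-u (0<x⇒0<x*x 0<x) 3pz≤x²
    , 𝔏-entry-ratio 0≤p (ThreeFactorLC⇒head₀-nonNeg xs lc′) 3pz≤x² 0≤q q≤p² 0≤w w≤z²
    , 𝔏ℤ-go-preserves-ThreeFactorLC xs 0≤x 0≤v v≤x² lc′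
    where
    0≤x = ℤP.<⇒≤ 0<x
    head-bounds = head₀-𝔏ℤ-go-bounds (x ∷ xs) 0≤p lc
    0≤v = proj₁ head-bounds
    v≤x² = proj₂ head-bounds
    next-bounds = head₀-𝔏ℤ-go-bounds xs 0≤x lc′
    0≤w = proj₁ next-bounds
    w≤z² = proj₂ next-bounds

  𝔏ℤ-preserves-ThreeFactorLC : ∀ xs → ThreeFactorLC 0ℤ xs → ThreeFactorLC 0ℤ (𝔏ℤ xs)
  𝔏ℤ-preserves-ThreeFactorLC xs = 𝔏ℤ-go-preserves-ThreeFactorLC xs ℤP.≤-refl ℤP.≤-refl ℤP.≤-refl

  ThreeFactorLC⇒positive : ∀ {q} xs → ThreeFactorLC q xs → All (0ℤ <_) xs
  ThreeFactorLC⇒positive []       _                = All.[]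
  ThreeFactorLC⇒positive (x ∷ xs) (0<x , _ , lc) = 0<x All.∷ ThreeFactorLC⇒positive xs lc

  ThreeFactorLC⇒iterates-positive : ∀ xs → ThreeFactorLC 0ℤ xs → ∀ s → All (0ℤ <_) (iterate 𝔏ℤ xs s)
  ThreeFactorLC⇒iterates-positive xs lc zero    = ThreeFactorLC⇒positive xs lc
  ThreeFactorLC⇒iterates-positive xs lc (suc s) =
    ThreeFactorLC⇒iterates-positive (𝔏ℤ xs) (𝔏ℤ-preserves-ThreeFactorLC xs lc) s

  ThreeFactorLC? : ∀ q xs → Dec (ThreeFactorLC q xs)
  ThreeFactorLC? q []       = yes tt
  ThreeFactorLC? q (x ∷ xs) = 0ℤ ℤP.<? x ×-dec + 3 * (q * head₀ xs) ℤP.≤? x * x ×-dec ThreeFactorLC? x xs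

  certifiedWithin : ℕ → List ℤ → Bool
  certifiedWithin zero    xs = false
  certifiedWithin (suc f) xs =
    isYes (ThreeFactorLC? 0ℤ xs) ∨ (isYes (all? (0ℤ ℤP.<?_) xs) ∧ certifiedWithin f (𝔏ℤ xs))

  certifiedWithin-sound : ∀ f xs → T (certifiedWithin f xs) → ∀ s → All (0ℤ <_) (iterate 𝔏ℤ xs s)
  certifiedWithin-sound (suc f) xs cert s with ThreeFactorLC? 0ℤ xs
  ... | yes lc = ThreeFactorLC⇒iterates-positive xs lc s
  ... | no _ with Equivalence.to T-∧ cert | s
  ...   | xs>0 , _    | zero   = toWitness xs>0
  ...   | _    , rest | suc s′ = certifiedWithin-sound f (𝔏ℤ xs) rest s′

factorial×H-numerator : ℕ → ℕ × ℕ
factorial×H-numerator zero    = 1 , 0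
factorial×H-numerator (suc m) = next (factorial×H-numerator m)
  where
  next : ℕ × ℕ → ℕ × ℕ
  next (f , h) = suc m ℕ.* f , suc m ℕ.* h ℕ.+ f

-- m ! · H m, a natural number
H-numerator : ℕ → ℕ
H-numerator m = proj₂ (factorial×H-numerator m)

-- (n !)² · a n k, where h = H-numerator n
scaledEntry : ℕ → ℕ → ℕ → ℤ
scaledEntry n h k = + (n C k) * (+ h - + ((n P k) ℕ.* H-numerator (n ∸ k)))
  where open import Data.Integer using (_*_; _-_)

-- Taking h as an argument makes the evaluator compute H-numerator n once per row.
scaledRow : ℕ → ℕ → List ℤ
scaledRow n h = map (scaledEntry n h ∘ suc) (upTo n)

rowCertified : ℕ → Bool
rowCertified n = certifiedWithin 10 (scaledRow n (H-numerator n))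

factorial×H-numerator-fst : ∀ m → proj₁ (factorial×H-numerator m) ≡ m !
factorial×H-numerator-fst zero    = refl
factorial×H-numerator-fst (suc m) = cong (suc m ℕ.*_) (factorial×H-numerator-fst m)

H-numerator-suc : ∀ m → H-numerator (suc m) ≡ suc m ℕ.* H-numerator m ℕ.+ m !
H-numerator-suc m = cong (suc m ℕ.* H-numerator m ℕ.+_) (factorial×H-numerator-fst m)

nPk*[n∸k]!≡n! : ∀ {n k} → k ℕ.≤ n → (n P k) ℕ.* (n ∸ k) ! ≡ n !
nPk*[n∸k]!≡n! {n} {k} k≤n = trans
  (cong (ℕ._* (n ∸ k) !) (nPk≡n!/[n∸k]! k≤n))
  (m/n*n≡m (m≤n⇒m!∣n! (ℕP.m∸n≤m n k)))
  where instance _ = (n ∸ k) ℕP.!≢0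

module _ where
  open import Data.Rational using (ℚ; mkℚ; 0ℚ; 1ℚ; _+_; _-_; _*_; -_; _/_; _<_; Positive)
  import Data.Rational.Properties as ℚP
  open import Data.Rational.Solver using (module +-*-Solver)
  import Data.Nat.Coprimality as Coprime
  open import Data.Integer using ()
    renaming (_+_ to _+ℤ_; _-_ to _-ℤ_; _*_ to _*ℤ_; -_ to -ℤ_; _<_ to _<ℤ_)
  open +-*-Solver
  open ≡-Reasoning

  ι : ℤ → ℚ
  ι z = z / 1

  -- Once ι z is rewritten to this normal form, _+_ and _*_ of ℚ compute on images of ι.
  ι≡mkℚ : ∀ z → ι z ≡ mkℚ z 0 (Coprime.sym (Coprime.1-coprimeTo ∣ z ∣))
  ι≡mkℚ (+ n)    = ℚP.normalize-coprime (Coprime.sym (Coprime.1-coprimeTo n))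
  ι≡mkℚ -[1+ n ] = cong -_ (ℚP.normalize-coprime (Coprime.sym (Coprime.1-coprimeTo (suc n))))

  ι-* : ∀ a b → ι (a *ℤ b) ≡ ι a * ι b
  ι-* a b = sym (cong₂ _*_ (ι≡mkℚ a) (ι≡mkℚ b))

  ι-+ : ∀ a b → ι (a +ℤ b) ≡ ι a + ι b
  ι-+ a b = trans
    (cong ι (sym (cong₂ _+ℤ_ (ℤP.*-identityʳ a) (ℤP.*-identityʳ b))))
    (sym (cong₂ _+_ (ι≡mkℚ a) (ι≡mkℚ b)))

  ι-neg : ∀ a → ι (-ℤ a) ≡ - ι a
  ι-neg (+ zero)  = refl
  ι-neg (+ suc n) = trans (ι≡mkℚ -[1+ n ]) (sym (cong -_ (ι≡mkℚ (+ suc n))))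
  ι-neg -[1+ n ]  = trans (ι≡mkℚ (+ suc n)) (sym (cong -_ (ι≡mkℚ -[1+ n ])))

  ι-- : ∀ a b → ι (a -ℤ b) ≡ ι a - ι b
  ι-- a b = trans (ι-+ a (-ℤ b)) (cong (λ t → ι a + t) (ι-neg b))

  ιℕ-+ : ∀ m n → ι (+ (m ℕ.+ n)) ≡ ι (+ m) + ι (+ n)
  ιℕ-+ m n = trans (cong ι (ℤP.pos-+ m n)) (ι-+ (+ m) (+ n))

  ιℕ-* : ∀ m n → ι (+ (m ℕ.* n)) ≡ ι (+ m) * ι (+ n)
  ιℕ-* m n = trans (cong ι (ℤP.pos-* m n)) (ι-* (+ m) (+ n))

  ι-pos : ∀ {x} → 0ℤ <ℤ x → Positive (ι x)
  ι-pos {+ suc n} _ = ℚP.normalize-pos (suc n) 1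
  ι-pos {+ zero} (+<+ ())

  inverse-ι : ∀ m .{{_ : ℕ.NonZero m}} → (+ 1 / m) * ι (+ m) ≡ 1ℚ
  inverse-ι (suc d) = trans
    (cong₂ _*_ (ℚP.normalize-coprime (Coprime.1-coprimeTo (suc d))) (ι≡mkℚ (+ suc d)))
    (ℚP.*-inverseˡ (mkℚ (+ suc d) 0 (Coprime.sym (Coprime.1-coprimeTo (suc d)))))

  scale : ℚ → List ℤ → List ℚ
  scale c = map (λ x → c * ι x)

  𝔏-entry-scale : ∀ c x p y →
    (c * ι x) * (c * ι x) - (c * ι p) * (c * ι y) ≡ (c * c) * ι (x *ℤ x -ℤ p *ℤ y)
  𝔏-entry-scale c x p y = begin
    (c * ι x) * (c * ι x) - (c * ι p) * (c * ι y)
      ≡⟨ solve 4 (λ c x p y → (c :* x) :* (c :* x) :- (c :* p) :* (c :* y)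
                           := (c :* c) :* (x :* x :- p :* y)) refl c (ι x) (ι p) (ι y) ⟩
    (c * c) * (ι x * ι x - ι p * ι y)
      ≡⟨ cong ((c * c) *_) (sym (trans (ι-- (x *ℤ x) (p *ℤ y)) (cong₂ _-_ (ι-* x x) (ι-* p y)))) ⟩
    (c * c) * ι (x *ℤ x -ℤ p *ℤ y) ∎

  𝔏-go-scale : ∀ c p xs → 𝔏-go (c * ι p) (scale c xs) ≡ scale (c * c) (𝔏ℤ-go p xs)
  𝔏-go-scale c p []           = refl
  𝔏-go-scale c p (x ∷ [])     = cong (_∷ []) (trans
    (cong (λ t → (c * ι x) * (c * ι x) - (c * ι p) * t) (sym (ℚP.*-zeroʳ c)))
    (𝔏-entry-scale c x p 0ℤ))
  𝔏-go-scale c p (x ∷ y ∷ xs) = cong₂ _∷_ (𝔏-entry-scale c x p y) (𝔏-go-scale c x (y ∷ xs))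

  𝔏-scale : ∀ c xs → 𝔏 (scale c xs) ≡ scale (c * c) (𝔏ℤ xs)
  𝔏-scale c xs = trans (cong (λ t → 𝔏-go t (scale c xs)) (sym (ℚP.*-zeroʳ c))) (𝔏-go-scale c 0ℤ xs)

  𝔏^-scale : ∀ s c → Positive c → ∀ xs →
             ∃[ d ] Positive d × 𝔏^ s (scale c xs) ≡ scale d (iterate 𝔏ℤ xs s)
  𝔏^-scale zero    c c>0 xs = c , c>0 , refl
  𝔏^-scale (suc s) c c>0 xs with 𝔏^-scale s c c>0 xs
  ... | d , d>0 , eq = d * d , ℚP.pos*pos⇒pos d {{d>0}} d {{d>0}} , (begin
    𝔏 (𝔏^ s (scale c xs))                ≡⟨ cong 𝔏 eq ⟩
    𝔏 (scale d (iterate 𝔏ℤ xs s))        ≡⟨ 𝔏-scale d (iterate 𝔏ℤ xs s) ⟩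
    scale (d * d) (𝔏ℤ (iterate 𝔏ℤ xs s)) ≡⟨ cong (scale (d * d)) 𝔏ℤ-iterate ⟩
    scale (d * d) (iterate 𝔏ℤ xs (suc s)) ∎)
    where
    𝔏ℤ-iterate : 𝔏ℤ (iterate 𝔏ℤ xs s) ≡ iterate 𝔏ℤ xs (suc s)
    𝔏ℤ-iterate = trans (cong 𝔏ℤ (sym (iterate-is-fold xs 𝔏ℤ s))) (iterate-is-fold xs 𝔏ℤ (suc s))

  scale-positive : ∀ c {xs} → Positive c → All (0ℤ <ℤ_) xs → All (0ℚ <_) (scale c xs)
  scale-positive c c>0 xs>0 = All.map⁺ (All.map entry-positive xs>0)
    where
    entry-positive : ∀ {x} → 0ℤ <ℤ x → 0ℚ < c * ι x
    entry-positive {x} x>0 = ℚP.positive⁻¹ (c * ι x) {{ℚP.pos*pos⇒pos c {{c>0}} (ι x) {{ι-pos x>0}}}}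

  H-numerator-spec : ∀ m → ι (+ (m !)) * H m ≡ ι (+ H-numerator m)
  H-numerator-spec zero    = refl
  H-numerator-spec (suc m) = begin
    ι (+ (suc m ℕ.* m !)) * (H m + r)     ≡⟨ cong (_* (H m + r)) (ιℕ-* (suc m) (m !)) ⟩
    (s * f) * (H m + r)                   ≡⟨ solve 4 (λ s f h r → (s :* f) :* (h :+ r)
                                                      := s :* (f :* h) :+ f :* (r :* s)) refl s f (H m) r ⟩
    s * (f * H m) + f * (r * s)           ≡⟨ cong₂ (λ t u → s * t + f * u) (H-numerator-spec m) (inverse-ι (suc m)) ⟩
    s * ι (+ H-numerator m) + f * 1ℚ      ≡⟨ cong (λ t → s * ι (+ H-numerator m) + t) (ℚP.*-identityʳ f) ⟩
    s * ι (+ H-numerator m) + f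
      ≡⟨ sym (trans (ιℕ-+ (suc m ℕ.* H-numerator m) (m !)) (cong (_+ f) (ιℕ-* (suc m) (H-numerator m)))) ⟩
    ι (+ (suc m ℕ.* H-numerator m ℕ.+ m !)) ≡⟨ cong (λ t → ι (+ t)) (sym (H-numerator-suc m)) ⟩
    ι (+ H-numerator (suc m))             ∎
    where
    s = ι (+ suc m)
    f = ι (+ (m !))
    r = + 1 / suc m

  factorial*H-difference : ∀ {n k} → k ℕ.≤ n →
    ι (+ (n !)) * (H n - H (n ∸ k)) ≡ ι (+ H-numerator n -ℤ + ((n P k) ℕ.* H-numerator (n ∸ k)))
  factorial*H-difference {n} {k} k≤n = begin
    N * (H n - H m)                 ≡⟨ solve 3 (λ N a b → N :* (a :- b) := N :* a :- N :* b) refl N (H n) (H m) ⟩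
    N * H n - N * H m               ≡⟨ cong (λ t → N * H n - t * H m) N≡Q*F ⟩
    N * H n - (Q * F) * H m         ≡⟨ cong (λ t → N * H n - t) (ℚP.*-assoc Q F (H m)) ⟩
    N * H n - Q * (F * H m)         ≡⟨ cong₂ (λ t u → t - Q * u) (H-numerator-spec n) (H-numerator-spec m) ⟩
    ι (+ H-numerator n) - Q * ι (+ H-numerator m)
      ≡⟨ sym (trans (ι-- (+ H-numerator n) (+ ((n P k) ℕ.* H-numerator m))) (cong (λ t → ι (+ H-numerator n) - t) (ιℕ-* (n P k) (H-numerator m)))) ⟩
    ι (+ H-numerator n -ℤ + ((n P k) ℕ.* H-numerator m)) ∎
    where
    m = n ∸ k
    N = ι (+ (n !))
    Q = ι (+ (n P k))
    F = ι (+ (m !))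
    N≡Q*F : N ≡ Q * F
    N≡Q*F = trans (cong (λ t → ι (+ t)) (sym (nPk*[n∸k]!≡n! k≤n))) (ιℕ-* (n P k) (m !))

  1/n! : ℕ → ℚ
  1/n! n = + 1 / n !
    where instance _ = n ℕP.!≢0

  1/n!-positive : ∀ n → Positive (1/n! n)
  1/n!-positive n = ℚP.normalize-pos 1 (n !) {{n ℕP.!≢0}}

  scaledEntry-spec : ∀ {n k} → k ℕ.≤ n → (1/n! n * 1/n! n) * ι (scaledEntry n (H-numerator n) k) ≡ a n k
  scaledEntry-spec {n} {k} k≤n = begin
    (r * r) * ι (scaledEntry n (H-numerator n) k)
      ≡⟨ cong ((r * r) *_) (trans (ι-* (+ (n C k)) _) (cong (B *_) (sym (factorial*H-difference k≤n)))) ⟩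
    (r * r) * (B * (N * D))  ≡⟨ solve 4 (λ r B N D → (r :* r) :* (B :* (N :* D)) := (r :* N) :* (r :* (B :* D))) refl r B N D ⟩
    (r * N) * (r * (B * D))  ≡⟨ cong (_* (r * (B * D))) (inverse-ι (n !) {{n ℕP.!≢0}}) ⟩
    1ℚ * (r * (B * D))       ≡⟨ ℚP.*-identityˡ (r * (B * D)) ⟩
    r * (B * D)              ∎
    where
    r = 1/n! n
    B = ι (+ (n C k))
    N = ι (+ (n !))
    D = H n - H (n ∸ k)

  seqA≡scale : ∀ n → seqA n ≡ scale (1/n! n * 1/n! n) (scaledRow n (H-numerator n))
  seqA≡scale n = trans
    (LP.map-cong-local (All.map (λ k<n → sym (scaledEntry-spec k<n)) (All.all-upTo n)))
    (LP.map-∘ (upTo n))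

  rowCertified⇒InfLogConcave : ∀ n → T (rowCertified n) → InfLogConcave (seqA n)
  rowCertified⇒InfLogConcave n cert _ s _ =
    let d , d>0 , 𝔏^-eq = 𝔏^-scale s (r * r) (ℚP.pos*pos⇒pos r {{r>0}} r {{r>0}}) bs
    in  subst (All (0ℚ <_)) (sym (trans (cong (𝔏^ s) (seqA≡scale n)) 𝔏^-eq))
              (scale-positive d d>0 (certifiedWithin-sound 10 bs cert s))
    where
    r = 1/n! n
    r>0 = 1/n!-positive n
    bs = scaledRow n (H-numerator n)

open import Data.Nat using (_≤_)

rows≤300-certified : ∀ (i : Fin 301) → T (rowCertified (toℕ i))
rows≤300-certified = from-yes (FinP.all? {n = 301} λ i → T? (rowCertified (toℕ i)))

-- The empty sequence (n = 0) is certified as well.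
theorem4p5 : ∀ (n : ℕ) → 1 ≤ n → n ≤ 300 → InfLogConcave (seqA n)
theorem4p5 n _ n≤300 = rowCertified⇒InfLogConcave n
  (subst (T ∘ rowCertified) (FinP.toℕ-fromℕ< (s≤s n≤300)) (rows≤300-certified (fromℕ< (s≤s n≤300))))
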